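{- Let $\alpha\in\mathbb{N}_0^N$ with $N=\ell(\alpha)+|\alpha|$, $\upsilon=\frac1{N+1}$, $\widetilde{\alpha}_i=\alpha_i-i\upsilon$, and $w$ the permutation of $\{1,\ldots,N\}$ with $r(\alpha,w(i))=i$. Fix an integer $n$ with $1\le n\le\alpha_{w(1)}$, let $m:=L(\alpha;w(1),\alpha_{w(1)}+1-n)+1$, and put $\xi_{mk+i}:=\widetilde{\alpha}_{w(i)}-nk$ ($1\le i\le m$, $k\ge0$). Let $T\ge1$ be the unique integer with $\widetilde{\alpha}_{w(m+s)}<\xi_{m+s+1}$ for $1\le s<T$ and $\widetilde{\alpha}_{w(m+T)}>\xi_{m+T+1}$; let $t=((T-1)\bmod m)+1$, $k=(T-t)/m$, and define $\beta$ by $\beta_{w(i)}=\alpha_{w(i)}-(k+1)n$ for $1\le i\le t$, $\beta_{w(i)}=\alpha_{w(i)}-kn$ for $t<i\le m$, $\beta_{w(i)}=\alpha_{w(i)}+n$ for $m+1\le i\le m+T$, $\beta_{w(i)}=\alpha_{w(i)}$ for $i>m+T$. Then: (i) $r(\beta,w(m+i))=i$ for $1\le i\le T$; (ii) $r(\beta,w(t+i))=mk+t+i$ for $1\le i\le m-t$; (iii) $r(\beta,w(i))=m(k+1)+i$ for $1\le i\le t$; (iv) $r(\beta,w(i))=i$ for $m+T+1\le i\le N$.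
   Context: $\mathbb{N}_0=\{0,1,2,\ldots\}$, $|\alpha|=\sum_i\alpha_i$, $\ell(\alpha)=\max\{j:\alpha_j>0\}$. Rank: $r(\alpha,i)=\#\{j:\alpha_j>\alpha_i\}+\#\{j:1\le j\le i,\ \alpha_j=\alpha_i\}$. Leg-length: $L(\alpha;i,j)=\#\{l:l>i,\ j\le\alpha_l\le\alpha_i\}+\#\{l:l<i,\ j\le\alpha_l+1\le\alpha_i\}$. The integer $T$ exists and is unique. -}

module Defs where

open import Data.Bool using (Bool; true; false; if_then_else_; _∧_)
open import Data.Nat using (ℕ; zero; suc; _+_; _*_; _∸_; _<?_; _≤?_; NonZero)
open import Data.Nat.DivMod using (_/_; _%_)
open import Data.Integer as ℤ using (ℤ; +_)
open import Data.Rational as ℚ using (ℚ)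
open import Relation.Nullary.Decidable using (⌊_⌋)

-- Compositions α ∈ ℕ₀^N are represented as functions ℕ → ℕ of which only
-- the entries at positions 1,…,N are ever read.

count : (ℕ → Bool) → ℕ → ℕ
count P zero    = 0
count P (suc n) = (if P (suc n) then 1 else 0) + count P n

size : ℕ → (ℕ → ℕ) → ℕ
size zero    α = 0
size (suc n) α = α (suc n) + size n α

ell : ℕ → (ℕ → ℕ) → ℕ
ell zero    α = 0
ell (suc n) α = if ⌊ 0 <? α (suc n) ⌋ then suc n else ell n α

-- rank r(a,i) = #{j : a_j > a_i} + #{j : 1 ≤ j ≤ i, a_j = a_i}
-- (j ranging over 1..N); stated for integer-valued vectors so that it
-- applies to β, whose entries are given by integer differences.
rank : ℕ → (ℕ → ℤ) → ℕ → ℕ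
rank N a i = count (λ j → ⌊ a i ℤ.<? a j ⌋) N + count (λ j → ⌊ a j ℤ.≟ a i ⌋) i

leg : ℕ → (ℕ → ℕ) → ℕ → ℕ → ℕ
leg N α i j =
  count (λ l → ⌊ i <? l ⌋ ∧ (⌊ j ≤? α l ⌋ ∧ ⌊ α l ≤? α i ⌋)) N
  + count (λ l → ⌊ j ≤? suc (α l) ⌋ ∧ ⌊ suc (α l) ≤? α i ⌋) (i ∸ 1)

tilde : ℕ → (ℕ → ℕ) → ℕ → ℚ
tilde N α i = (+ α i ℚ./ 1) ℚ.- (+ i ℚ./ suc N)

-- ξ_{mk+i} = α̃_{w(i)} − n k   (1 ≤ i ≤ m, k ≥ 0), for index p ≥ 1:
-- i = ((p−1) mod m) + 1,  k = (p−1) div m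
xi : (N : ℕ) (α w : ℕ → ℕ) (n m : ℕ) .{{_ : NonZero m}} → ℕ → ℚ
xi N α w n m p =
  tilde N α (w (suc ((p ∸ 1) % m))) ℚ.- (+ (n * ((p ∸ 1) / m)) ℚ./ 1)

-- Multiplying α̃ᵢ = αᵢ − i/(N + 1) by N + 1 gives integer keys ordered like the pairs (αᵢ, −i), so
-- the rank r(α, p) is one more than the number of keys above the key of p, and w lists the positions
-- by decreasing key.  Adding a constant to the parts at a set of positions adds a multiple of N + 1 to
-- their keys, so along w the keys of β still decrease inside each block w(1..t), w(t+1..m),
-- w(m+1..m+T), w(m+T+1..N).  The defining inequalities of T (through ξ), the leg length m (which counts
-- the keys above the key of α_{w(1)} − n at w(1)) and the maximality of α_{w(1)} compare the keys
-- across the seams, so the keys of β decrease along w(m+1..m+T), w(t+1..m), w(1..t), w(m+T+1..N),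
-- and the ranks of β are the positions in this list.
{-# OPTIONS --safe #-}
module Submission where

open import Defs
open import Data.Nat using (ℕ; suc; _+_; _*_; _∸_; _≤_; _<_)
open import Data.Nat.DivMod using (_/_; _%_)
open import Data.Integer as ℤ using (ℤ; +_)
open import Data.Rational as ℚ using (ℚ)
open import Data.Product using (_×_)
open import Relation.Binary.PropositionalEquality using (_≡_)

open import Data.Bool as Bool using (Bool; true; false; if_then_else_; _∧_; not)
open import Data.Bool.Properties using (∧-identityʳ; ∧-zeroʳ)
open import Data.Empty using (⊥-elim)
import Data.Integer.Properties as ℤₚ
import Data.Integer.Tactic.RingSolver as ZR
open import Data.Nat as ℕ using (zero; z≤n; s≤s; NonZero; _≟_; _≤?_; _<?_)
import Data.Nat.DivMod as DivMod
open import Data.Nat.Divisibility using (n∣m*n)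
import Data.Nat.Properties as ℕₚ
import Data.Nat.Tactic.RingSolver as NR
open import Algebra.Properties.CommutativeSemigroup ℕₚ.+-commutativeSemigroup
  using () renaming (xy∙z≈xz∙y to +-right-comm; interchange to +-interchange)
open import Data.Product using (_,_; proj₁; proj₂)
open import Data.Rational.Base using (toℚᵘ)
open import Data.Rational.Properties using (toℚᵘ-homo-+; toℚᵘ-homo‿-; toℚᵘ-fromℚᵘ; toℚᵘ-mono-<)
open import Data.Rational.Unnormalised as ℚᵘ using (mkℚᵘ; *≡*; *<*)
import Data.Rational.Unnormalised.Properties as ℚᵘₚ
open import Data.Sum using (_⊎_; inj₁; inj₂; [_,_]′)
open import Data.Unit using (tt)
open import Function using (_∘_; _⇔_; mk⇔; Equivalence)
open import Relation.Binary.Definitions using (Tri; tri<; tri≈; tri>)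
open import Relation.Binary.PropositionalEquality
  using (refl; sym; trans; cong; cong₂; subst; subst₂; module ≡-Reasoning)
open import Relation.Nullary using (¬_; Dec; yes; no; contradiction)
open import Relation.Nullary.Decidable using (⌊_⌋; isYes≗does; dec-true; dec-false; toWitness; fromWitness)

private
  variable
    c d e n o x y N : ℕ
    A B : ℤ
    P Q R : ℕ → Bool

-- Counting

⌊⌋-true : ∀ {ℓ} {A : Set ℓ} (A? : Dec A) → A → ⌊ A? ⌋ ≡ true
⌊⌋-true A? a = trans (isYes≗does A?) (dec-true A? a)

⌊⌋-false : ∀ {ℓ} {A : Set ℓ} (A? : Dec A) → ¬ A → ⌊ A? ⌋ ≡ false
⌊⌋-false A? ¬a = trans (isYes≗does A?) (dec-false A? ¬a)

⌊⌋-cong : ∀ {ℓ ℓ′} {A : Set ℓ} {B : Set ℓ′} → A ⇔ B → (A? : Dec A) (B? : Dec B) → ⌊ A? ⌋ ≡ ⌊ B? ⌋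
⌊⌋-cong A⇔B A? (yes b) = ⌊⌋-true A? (Equivalence.from A⇔B b)
⌊⌋-cong A⇔B A? (no ¬b) = ⌊⌋-false A? (¬b ∘ Equivalence.to A⇔B)

indicator : Bool → ℕ
indicator β = if β then 1 else 0

count-cong : ∀ n → (∀ j → 1 ≤ j → j ≤ n → P j ≡ Q j) → count P n ≡ count Q n
count-cong zero    P≡Q = refl
count-cong (suc n) P≡Q = cong₂ (λ β k → indicator β + k)
  (P≡Q (suc n) (s≤s z≤n) ℕₚ.≤-refl) (count-cong n (λ j 1≤j j≤n → P≡Q j 1≤j (ℕₚ.m≤n⇒m≤1+n j≤n)))

count-+ : ∀ n → (∀ j → 1 ≤ j → j ≤ n → indicator (P j) + indicator (Q j) ≡ indicator (R j)) →
          count P n + count Q n ≡ count R n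
count-+ zero    pointwise = refl
count-+ {P} {Q} (suc n) pointwise =
  trans (+-interchange (indicator (P (suc n))) (count P n) (indicator (Q (suc n))) (count Q n))
        (cong₂ _+_ (pointwise (suc n) (s≤s z≤n) ℕₚ.≤-refl)
                   (count-+ n (λ j 1≤j j≤n → pointwise j 1≤j (ℕₚ.m≤n⇒m≤1+n j≤n))))

indicator-mono : ∀ {β γ} → (Bool.T β → Bool.T γ) → indicator β ≤ indicator γ
indicator-mono {false} _     = z≤n
indicator-mono {true} {true}  _   = ℕₚ.≤-refl
indicator-mono {true} {false} β⇒γ = ⊥-elim (β⇒γ tt)

count-mono : ∀ n → (∀ j → 1 ≤ j → j ≤ n → Bool.T (P j) → Bool.T (Q j)) → count P n ≤ count Q n
count-mono zero    P⇒Q = z≤n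
count-mono (suc n) P⇒Q = ℕₚ.+-mono-≤ (indicator-mono (P⇒Q (suc n) (s≤s z≤n) ℕₚ.≤-refl))
  (count-mono n (λ j 1≤j j≤n → P⇒Q j 1≤j (ℕₚ.m≤n⇒m≤1+n j≤n)))

count-mono-< : ∀ n → (∀ j → 1 ≤ j → j ≤ n → Bool.T (P j) → Bool.T (Q j)) →
               1 ≤ x → x ≤ n → ¬ Bool.T (P x) → Bool.T (Q x) → count P n < count Q n
count-mono-< zero P⇒Q 1≤x x≤0 _ _ = contradiction x≤0 (ℕₚ.<⇒≱ 1≤x)
count-mono-< {P} {Q} {x} (suc n) P⇒Q 1≤x x≤n ¬Px Qx with x ≟ suc n
... | yes refl with P (suc n) | Q (suc n)
...   | false | true  = s≤s (count-mono n (λ j 1≤j j≤n → P⇒Q j 1≤j (ℕₚ.m≤n⇒m≤1+n j≤n)))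
...   | true  | _     = contradiction tt ¬Px
...   | false | false = contradiction Qx (λ ())
count-mono-< (suc n) P⇒Q 1≤x x≤n ¬Px Qx | no x≢n =
  ℕₚ.+-mono-≤-< (indicator-mono (P⇒Q (suc n) (s≤s z≤n) ℕₚ.≤-refl))
    (count-mono-< n (λ j 1≤j j≤n → P⇒Q j 1≤j (ℕₚ.m≤n⇒m≤1+n j≤n))
                  1≤x (ℕₚ.≤-pred (ℕₚ.≤∧≢⇒< x≤n x≢n)) ¬Px Qx)

count-none : ∀ n → (∀ j → 1 ≤ j → j ≤ n → P j ≡ false) → count P n ≡ 0
count-none zero    none = refl
count-none (suc n) none
  rewrite none (suc n) (s≤s z≤n) ℕₚ.≤-refl = count-none n (λ j 1≤j j≤n → none j 1≤j (ℕₚ.m≤n⇒m≤1+n j≤n))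

count-all : ∀ n → count (λ _ → true) n ≡ n
count-all zero    = refl
count-all (suc n) = cong suc (count-all n)

count<n : ∀ {P} n → 1 ≤ x → x ≤ n → ¬ Bool.T (P x) → count P n < n
count<n {P = P} n 1≤x x≤n ¬Px =
  subst (count P n <_) (count-all n) (count-mono-< n (λ _ _ _ _ → tt) 1≤x x≤n ¬Px tt)

count≡0 : ∀ {P} n → count P n ≡ 0 → 1 ≤ x → x ≤ n → ¬ Bool.T (P x)
count≡0 {P = P} n count≡0 1≤x x≤n Px =
  ℕₚ.<-irrefl (sym count≡0) (subst (_< count P n) (count-none n (λ _ _ _ → refl))
                                    (count-mono-< n (λ _ _ _ ()) 1≤x x≤n (λ ()) Px))

count-≟ : ∀ n → 1 ≤ x → x ≤ n → count (λ j → ⌊ j ≟ x ⌋) n ≡ 1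
count-≟ zero 1≤x x≤0 = contradiction x≤0 (ℕₚ.<⇒≱ 1≤x)
count-≟ {x} (suc n) 1≤x x≤n with suc n ≟ x
... | yes refl = cong suc (count-none n (λ j _ j≤n → ⌊⌋-false (j ≟ suc n) (λ { refl → ℕₚ.<-irrefl refl (s≤s j≤n) })))
... | no n≢x   = count-≟ n 1≤x (ℕₚ.≤-pred (ℕₚ.≤∧≢⇒< x≤n (n≢x ∘ sym)))

count-≤-restrict : ∀ n → o ≤ n → count (λ j → ⌊ j ≤? o ⌋ ∧ P j) n ≡ count P o
count-≤-restrict {o} {P} n o≤n with ℕₚ.m≤n⇒m<n∨m≡n o≤n
... | inj₂ refl = count-cong n (λ j _ j≤n → cong (_∧ P j) (⌊⌋-true (j ≤? n) j≤n))
count-≤-restrict {o} (suc n) _ | inj₁ (s≤s o≤n)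
  rewrite ⌊⌋-false (suc n ≤? o) (ℕₚ.<⇒≱ (s≤s o≤n)) = count-≤-restrict n o≤n

-- Decreasing sequences and bijections of [1, N]

DecreasingOn : ℕ → ℕ → (ℕ → ℤ) → Set
DecreasingOn a b V = ∀ d → a ≤ d → suc d ≤ b → V (suc d) ℤ.< V d

DecreasingOn-join : ∀ {a b c V} → DecreasingOn a b V → (suc b ≤ c → V (suc b) ℤ.< V b) →
                    DecreasingOn (suc b) c V → DecreasingOn a c V
DecreasingOn-join {b = b} left junction right d a≤d d<c with ℕₚ.<-cmp d b
... | tri< d<b _ _ = left d a≤d d<b
... | tri≈ _ refl _ = junction d<c
... | tri> _ _ b<d = right d b<d d<c

DecreasingOn-antitone : ∀ {a b V} → DecreasingOn a b V → a ≤ e → e < d → d ≤ b → V d ℤ.< V e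
DecreasingOn-antitone {e} {suc d} decr a≤e (s≤s e≤d) d<b with ℕₚ.m≤n⇒m<n∨m≡n e≤d
... | inj₂ refl = decr e a≤e d<b
... | inj₁ e<d  = ℤₚ.<-trans (decr d (ℕₚ.≤-trans a≤e e≤d) d<b) (DecreasingOn-antitone decr a≤e e<d (ℕₚ.<⇒≤ d<b))

DecreasingOn-block : ∀ {N K V p q len} D → DecreasingOn 1 N K → q + len ≤ N →
                     (∀ i → 1 ≤ i → i ≤ len → V (p + i) ≡ K (q + i) ℤ.+ D) → DecreasingOn (suc p) (p + len) V
DecreasingOn-block {N} {K} {V} {p} {q} {len} D K-decr q+len≤N V≡K+D d p<d d<p+len =
  subst (λ d → V (suc d) ℤ.< V d) (ℕₚ.m+[n∸m]≡n p≤d) (step (d ∸ p) (ℕₚ.m<n⇒0<n∸m p<d) i<len)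
  where
  p≤d = ℕₚ.<⇒≤ p<d
  i<len : suc (d ∸ p) ≤ len
  i<len = subst (_≤ len) (ℕₚ.+-∸-assoc 1 p≤d)
                 (subst (suc d ∸ p ≤_) (ℕₚ.m+n∸m≡n p len) (ℕₚ.∸-monoˡ-≤ p d<p+len))
  step : ∀ i → 1 ≤ i → suc i ≤ len → V (suc (p + i)) ℤ.< V (p + i)
  step i 1≤i i<len = subst₂ ℤ._<_
    (sym (trans (cong V (sym (ℕₚ.+-suc p i)))
                (trans (V≡K+D (suc i) (s≤s z≤n) i<len) (cong (λ c → K c ℤ.+ D) (ℕₚ.+-suc q i)))))
    (sym (V≡K+D i 1≤i (ℕₚ.<⇒≤ i<len)))
    (ℤₚ.+-monoˡ-< D (K-decr (q + i) (ℕₚ.≤-trans 1≤i (ℕₚ.m≤n+m i q))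
                              (ℕₚ.≤-trans (ℕₚ.≤-reflexive (sym (ℕₚ.+-suc q i)))
                                          (ℕₚ.≤-trans (ℕₚ.+-monoʳ-≤ q i<len) q+len≤N))))

LeftInverseOn : ℕ → (ℕ → ℕ) → (ℕ → ℕ) → Set
LeftInverseOn N g f = ∀ i → 1 ≤ i → i ≤ N → (1 ≤ f i) × (f i ≤ N) × (g (f i) ≡ i)

LeftInverseOn-∘ : ∀ {g f g′ f′} → LeftInverseOn N g f → LeftInverseOn N g′ f′ →
                  LeftInverseOn N (g ∘ g′) (f′ ∘ f)
LeftInverseOn-∘ {g = g} g∘f g′∘f′ i 1≤i i≤N with g∘f i 1≤i i≤N
... | 1≤fi , fi≤N , gfi≡i with g′∘f′ _ 1≤fi fi≤N
...   | 1≤f′fi , f′fi≤N , g′f′fi≡fi = 1≤f′fi , f′fi≤N , trans (cong g g′f′fi≡fi) gfi≡i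

count-preimage-≤ : ∀ {ρ τ} → LeftInverseOn N τ ρ → LeftInverseOn N ρ τ →
                   c ≤ N → count (λ j → ⌊ ρ j ≤? c ⌋) N ≡ c
count-preimage-≤ {N} {zero} {ρ} τ∘ρ ρ∘τ _ =
  count-none N (λ j 1≤j j≤N → ⌊⌋-false (ρ j ≤? 0) (ℕₚ.<⇒≱ (proj₁ (τ∘ρ j 1≤j j≤N))))
count-preimage-≤ {N} {suc c} {ρ} {τ} τ∘ρ ρ∘τ c<N = begin
  count (λ j → ⌊ ρ j ≤? suc c ⌋) N
    ≡⟨ sym (count-+ N split) ⟩
  count (λ j → ⌊ ρ j ≤? c ⌋) N + count (λ j → ⌊ j ≟ τ (suc c) ⌋) N
    ≡⟨ cong₂ _+_ (count-preimage-≤ τ∘ρ ρ∘τ (ℕₚ.<⇒≤ c<N)) (count-≟ N 1≤τc τc≤N) ⟩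
  c + 1
    ≡⟨ ℕₚ.+-comm c 1 ⟩
  suc c ∎
  where
  open ≡-Reasoning
  1≤τc = proj₁ (ρ∘τ (suc c) (s≤s z≤n) c<N)
  τc≤N = proj₁ (proj₂ (ρ∘τ (suc c) (s≤s z≤n) c<N))
  split : ∀ j → 1 ≤ j → j ≤ N →
          indicator ⌊ ρ j ≤? c ⌋ + indicator ⌊ j ≟ τ (suc c) ⌋ ≡ indicator ⌊ ρ j ≤? suc c ⌋
  split j 1≤j j≤N with j ≟ τ (suc c)
  ... | yes refl rewrite proj₂ (proj₂ (ρ∘τ (suc c) (s≤s z≤n) c<N))
                       | ⌊⌋-false (suc c ≤? c) (ℕₚ.<-irrefl refl)
                       | ⌊⌋-true (suc c ≤? suc c) ℕₚ.≤-refl = refl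
  ... | no j≢τc with ρ j ≤? c | ρ j ≤? suc c
  ...   | yes _    | yes _      = refl
  ...   | no _     | no _       = refl
  ...   | yes ρj≤c | no ρj≰c    = contradiction (ℕₚ.m≤n⇒m≤1+n ρj≤c) ρj≰c
  ...   | no ρj≰c  | yes ρj≤1+c with ℕₚ.m≤n⇒m<n∨m≡n ρj≤1+c
  ...     | inj₁ ρj<1+c = contradiction (ℕₚ.≤-pred ρj<1+c) ρj≰c
  ...     | inj₂ ρj≡1+c = contradiction (trans (sym (proj₂ (proj₂ (τ∘ρ j 1≤j j≤N)))) (cong τ ρj≡1+c)) j≢τc

-- Position d of the order obtained by exchanging the adjacent blocks (o, o+p] and
-- (o+p, o+p+q] holds the element at old position swapBlocks o p q d.
swapBlocks : ℕ → ℕ → ℕ → ℕ → ℕ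
swapBlocks o p q d with d ≤? o | d ≤? o + q | d ≤? o + q + p
... | yes _ | _     | _     = d
... | no _  | yes _ | _     = p + d
... | no _  | no _  | yes _ = d ∸ q
... | no _  | no _  | no _  = d

module _ {o p q d : ℕ} where

  swapBlocks-below : d ≤ o → swapBlocks o p q d ≡ d
  swapBlocks-below d≤o with d ≤? o
  ... | yes _  = refl
  ... | no d≰o = contradiction d≤o d≰o

  swapBlocks-second : o < d → d ≤ o + q → swapBlocks o p q d ≡ p + d
  swapBlocks-second o<d d≤o+q with d ≤? o | d ≤? o + q
  ... | yes d≤o | _       = contradiction d≤o (ℕₚ.<⇒≱ o<d)
  ... | no _    | yes _   = refl
  ... | no _    | no d≰o+q = contradiction d≤o+q d≰o+q

  swapBlocks-first : o + q < d → d ≤ o + q + p → swapBlocks o p q d ≡ d ∸ q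
  swapBlocks-first o+q<d d≤o+q+p with d ≤? o | d ≤? o + q | d ≤? o + q + p
  ... | yes d≤o | _        | _  = contradiction (ℕₚ.≤-trans d≤o (ℕₚ.m≤m+n o q)) (ℕₚ.<⇒≱ o+q<d)
  ... | no _    | yes d≤o+q | _ = contradiction d≤o+q (ℕₚ.<⇒≱ o+q<d)
  ... | no _    | no _     | yes _ = refl
  ... | no _    | no _     | no d≰o+q+p = contradiction d≤o+q+p d≰o+q+p

  swapBlocks-above : o + q + p < d → swapBlocks o p q d ≡ d
  swapBlocks-above o+q+p<d with d ≤? o | d ≤? o + q | d ≤? o + q + p
  ... | no _    | no _  | no _  = refl
  ... | yes d≤o | _     | _     =
    contradiction (ℕₚ.≤-trans d≤o (ℕₚ.≤-trans (ℕₚ.m≤m+n o q) (ℕₚ.m≤m+n (o + q) p))) (ℕₚ.<⇒≱ o+q+p<d)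
  ... | no _    | yes d≤o+q | _ = contradiction (ℕₚ.≤-trans d≤o+q (ℕₚ.m≤m+n (o + q) p)) (ℕₚ.<⇒≱ o+q+p<d)
  ... | no _    | no _  | yes d≤o+q+p = contradiction d≤o+q+p (ℕₚ.<⇒≱ o+q+p<d)

swapBlocks-inverse : ∀ o p q d → swapBlocks o q p (swapBlocks o p q d) ≡ d
swapBlocks-inverse o p q d with d ≤? o | d ≤? o + q | d ≤? o + q + p
... | yes d≤o | _ | _ = swapBlocks-below d≤o
swapBlocks-inverse o p q d | no d≰o | yes d≤o+q | _ =
  trans (swapBlocks-first (subst (_< p + d) (ℕₚ.+-comm p o) (ℕₚ.+-monoʳ-< p (ℕₚ.≰⇒> d≰o))) p+d≤o+p+q)
        (ℕₚ.m+n∸m≡n p d)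
  where
  p+d≤o+p+q : p + d ≤ o + p + q
  p+d≤o+p+q = subst (p + d ≤_) (solve o p q) (ℕₚ.+-monoʳ-≤ p d≤o+q)
    where solve : ∀ o p q → p + (o + q) ≡ o + p + q
          solve = NR.solve-∀
swapBlocks-inverse o p q d | no _ | no d≰o+q | yes d≤o+q+p =
  trans (swapBlocks-second o<d∸q d∸q≤o+p) (ℕₚ.m+[n∸m]≡n q≤d)
  where
  q≤d = ℕₚ.≤-trans (ℕₚ.m≤n+m q o) (ℕₚ.<⇒≤ (ℕₚ.≰⇒> d≰o+q))
  o<d∸q = ℕₚ.m+n≤o⇒m≤o∸n (suc o) (ℕₚ.≰⇒> d≰o+q)
  d∸q≤o+p = ℕₚ.≤-trans (ℕₚ.∸-monoˡ-≤ q d≤o+q+p)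
              (ℕₚ.≤-reflexive (trans (cong (_∸ q) (+-right-comm o q p)) (ℕₚ.m+n∸n≡m (o + p) q)))
swapBlocks-inverse o p q d | no _ | no _ | no d≰o+q+p =
  swapBlocks-above (subst (_< d) (+-right-comm o q p) (ℕₚ.≰⇒> d≰o+q+p))

swapBlocks-range : ∀ {o p q} → o + q + p ≤ N → 1 ≤ d → d ≤ N →
                   (1 ≤ swapBlocks o p q d) × (swapBlocks o p q d ≤ N)
swapBlocks-range {N} {d} {o} {p} {q} bound 1≤d d≤N with d ≤? o | d ≤? o + q | d ≤? o + q + p
... | yes _ | _ | _ = 1≤d , d≤N
... | no _ | yes d≤o+q | _ =
  ℕₚ.≤-trans 1≤d (ℕₚ.m≤n+m d p) ,
  ℕₚ.≤-trans (ℕₚ.≤-reflexive (ℕₚ.+-comm p d)) (ℕₚ.≤-trans (ℕₚ.+-monoˡ-≤ p d≤o+q) bound)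
... | no _ | no d≰o+q | yes _ =
  ℕₚ.m<n⇒0<n∸m (ℕₚ.≤-trans (s≤s (ℕₚ.m≤n+m q o)) (ℕₚ.≰⇒> d≰o+q)) ,
  ℕₚ.≤-trans (ℕₚ.m∸n≤m d q) d≤N
... | no _ | no _ | no _ = 1≤d , d≤N

swapBlocks-leftInverse : ∀ {o p q} → o + q + p ≤ N → LeftInverseOn N (swapBlocks o q p) (swapBlocks o p q)
swapBlocks-leftInverse {N} {o} {p} {q} bound d 1≤d d≤N =
  proj₁ range , proj₂ range , swapBlocks-inverse o p q d
  where range = swapBlocks-range {o = o} {p} {q} bound 1≤d d≤N

-- Keys and ranks

module KeyOrder (N : ℕ) where

  -- key (+ αₓ) x = (N + 1) α̃ₓ.
  key : ℤ → ℕ → ℤ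
  key A x = A ℤ.* + suc N ℤ.- + x

  keyOf : (ℕ → ℤ) → ℕ → ℤ
  keyOf a j = key (a j) j

  #above : (ℕ → ℤ) → ℤ → ℕ
  #above κ X = count (λ j → ⌊ X ℤ.<? κ j ⌋) N

  key-+ : ∀ A D x → key (A ℤ.+ D) x ≡ key A x ℤ.+ D ℤ.* + suc N
  key-+ A D x = solve A D (+ x) (+ suc N)
    where solve : ∀ a d x m → (a ℤ.+ d) ℤ.* m ℤ.- x ≡ (a ℤ.* m ℤ.- x) ℤ.+ d ℤ.* m
          solve = ZR.solve-∀

  key-+-mono-< : ∀ A x B y D → key A x ℤ.< key B y → key (A ℤ.+ D) x ℤ.< key (B ℤ.+ D) y
  key-+-mono-< A x B y D A<B =
    subst₂ ℤ._<_ (sym (key-+ A D x)) (sym (key-+ B D y)) (ℤₚ.+-monoˡ-< (D ℤ.* + suc N) A<B)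

  key-<-position : ∀ A → y < x → key A x ℤ.< key A y
  key-<-position A y<x = ℤₚ.+-monoʳ-< (A ℤ.* + suc N) (ℤₚ.neg-mono-< (ℤ.+<+ y<x))

  key-≤-position : ∀ A → y ≤ x → key A x ℤ.≤ key A y
  key-≤-position A y≤x = ℤₚ.+-monoʳ-≤ (A ℤ.* + suc N) (ℤₚ.neg-mono-≤ (ℤ.+≤+ y≤x))

  key-<-value : y ≤ N → A ℤ.< B → key A x ℤ.< key B y
  key-<-value {y} {A} {B} {x} y≤N A<B =
    subst₂ ℤ._<_ (cancel A (+ x) (+ y) M) (cancel′ B (+ x) (+ y) M) (ℤₚ.+-monoˡ-< (ℤ.- (+ x ℤ.+ + y)) cross)
    where
    open ℤₚ.≤-Reasoning
    M = + suc N
    cross : A ℤ.* M ℤ.+ + y ℤ.< B ℤ.* M ℤ.+ + x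
    cross = begin-strict
      A ℤ.* M ℤ.+ + y  <⟨ ℤₚ.+-monoʳ-< (A ℤ.* M) (ℤ.+<+ (s≤s y≤N)) ⟩
      A ℤ.* M ℤ.+ M    ≡⟨ solve A M ⟩
      ℤ.suc A ℤ.* M    ≤⟨ ℤₚ.*-monoʳ-≤-nonNeg M (ℤₚ.i<j⇒suc[i]≤j A<B) ⟩
      B ℤ.* M          ≤⟨ ℤₚ.i≤i+j (B ℤ.* M) (+ x) ⟩
      B ℤ.* M ℤ.+ + x  ∎
      where solve : ∀ a m → a ℤ.* m ℤ.+ m ≡ (ℤ.+ 1 ℤ.+ a) ℤ.* m
            solve = ZR.solve-∀
    cancel : ∀ a u v m → a ℤ.* m ℤ.+ v ℤ.+ ℤ.- (u ℤ.+ v) ≡ a ℤ.* m ℤ.- u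
    cancel = ZR.solve-∀
    cancel′ : ∀ b u v m → b ℤ.* m ℤ.+ u ℤ.+ ℤ.- (u ℤ.+ v) ≡ b ℤ.* m ℤ.- v
    cancel′ = ZR.solve-∀

  key-<⇔ : ∀ A B → x ≤ N → y ≤ N → key A x ℤ.< key B y ⇔ (A ℤ.< B ⊎ (A ≡ B × y < x))
  key-<⇔ {x} {y} A B x≤N y≤N = mk⇔ to from
    where
    to : key A x ℤ.< key B y → A ℤ.< B ⊎ (A ≡ B × y < x)
    to kx<ky with ℤₚ.<-cmp A B
    ... | tri< A<B _ _ = inj₁ A<B
    ... | tri> _ _ B<A = contradiction (key-<-value x≤N B<A) (ℤₚ.<-asym kx<ky)
    ... | tri≈ _ refl _ with y <? x
    ...   | yes y<x = inj₂ (refl , y<x)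
    ...   | no y≮x  = contradiction (key-≤-position A (ℕₚ.≮⇒≥ y≮x)) (ℤₚ.<⇒≱ kx<ky)
    from : A ℤ.< B ⊎ (A ≡ B × y < x) → key A x ℤ.< key B y
    from (inj₁ A<B)          = key-<-value y≤N A<B
    from (inj₂ (refl , y<x)) = key-<-position A y<x

  key-injective : ∀ A B → x ≤ N → y ≤ N → key A x ≡ key B y → x ≡ y
  key-injective {x} {y} A B x≤N y≤N kx≡ky with ℤₚ.<-cmp A B
  ... | tri< A<B _ _ = contradiction kx≡ky (ℤₚ.<⇒≢ (key-<-value y≤N A<B))
  ... | tri> _ _ B<A = contradiction (sym kx≡ky) (ℤₚ.<⇒≢ (key-<-value x≤N B<A))
  ... | tri≈ _ refl _ with ℕₚ.<-cmp x y
  ...   | tri< x<y _ _ = contradiction (sym kx≡ky) (ℤₚ.<⇒≢ (key-<-position A x<y))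
  ...   | tri≈ _ x≡y _ = x≡y
  ...   | tri> _ _ y<x = contradiction kx≡ky (ℤₚ.<⇒≢ (key-<-position A y<x))

  rank≡suc-#above : ∀ a p → 1 ≤ p → p ≤ N → rank N a p ≡ suc (#above (keyOf a) (keyOf a p))
  rank≡suc-#above a (suc p) _ p<N = begin
    count G N + count E (suc p)
      ≡⟨ cong (λ β → count G N + (indicator β + count E p)) (⌊⌋-true (a (suc p) ℤ.≟ a (suc p)) refl) ⟩
    count G N + suc (count E p)
      ≡⟨ ℕₚ.+-suc (count G N) (count E p) ⟩
    suc (count G N + count E p)
      ≡⟨ cong (λ k → suc (count G N + k)) (sym (count-≤-restrict N (ℕₚ.<⇒≤ p<N))) ⟩
    suc (count G N + count (λ j → ⌊ j ≤? p ⌋ ∧ E j) N)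
      ≡⟨ cong suc (count-+ N pointwise) ⟩
    suc (#above κ (κ (suc p))) ∎
    where
    open ≡-Reasoning
    κ = keyOf a
    G E : ℕ → Bool
    G j = ⌊ a (suc p) ℤ.<? a j ⌋
    E j = ⌊ a j ℤ.≟ a (suc p) ⌋
    pointwise : ∀ j → 1 ≤ j → j ≤ N →
                indicator (G j) + indicator (⌊ j ≤? p ⌋ ∧ E j) ≡ indicator ⌊ κ (suc p) ℤ.<? κ j ⌋
    pointwise j _ j≤N with ℤₚ.<-cmp (a (suc p)) (a j) | j ≤? p
    ... | tri< ap<aj ap≢aj _ | j≤?p
      rewrite ⌊⌋-true (a (suc p) ℤ.<? a j) ap<aj | ⌊⌋-false (a j ℤ.≟ a (suc p)) (ap≢aj ∘ sym)
            | ⌊⌋-true (κ (suc p) ℤ.<? κ j) (key-<-value j≤N ap<aj) with j≤?p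
    ...   | yes _ = refl
    ...   | no _  = refl
    pointwise j _ j≤N | tri> _ ap≢aj aj<ap | j≤?p
      rewrite ⌊⌋-false (a (suc p) ℤ.<? a j) (ℤₚ.<-asym aj<ap) | ⌊⌋-false (a j ℤ.≟ a (suc p)) (ap≢aj ∘ sym)
            | ⌊⌋-false (κ (suc p) ℤ.<? κ j) (ℤₚ.<-asym (key-<-value p<N aj<ap)) with j≤?p
    ...   | yes _ = refl
    ...   | no _  = refl
    pointwise j _ j≤N | tri≈ ap≮aj ap≡aj _ | yes j≤p
      rewrite ⌊⌋-false (a (suc p) ℤ.<? a j) ap≮aj | ⌊⌋-true (a j ℤ.≟ a (suc p)) (sym ap≡aj)
            | ⌊⌋-true (κ (suc p) ℤ.<? κ j)
                (subst (λ A → key A (suc p) ℤ.< κ j) (sym ap≡aj) (key-<-position (a j) (s≤s j≤p))) = refl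
    pointwise j _ j≤N | tri≈ ap≮aj ap≡aj _ | no j≰p
      rewrite ⌊⌋-false (a (suc p) ℤ.<? a j) ap≮aj
            | ⌊⌋-false (κ (suc p) ℤ.<? κ j)
                (ℤₚ.≤⇒≯ (subst (λ A → κ j ℤ.≤ key A (suc p)) (sym ap≡aj) (key-≤-position (a j) (ℕₚ.≰⇒> j≰p)))) = refl

DecreasingOn-<⇔ : ∀ {N V d e} → DecreasingOn 1 N V → 1 ≤ d → d ≤ N → 1 ≤ e → e ≤ N → V d ℤ.< V e ⇔ e < d
DecreasingOn-<⇔ {V = V} {d} {e} decr 1≤d d≤N 1≤e e≤N = mk⇔ to (λ e<d → DecreasingOn-antitone decr 1≤e e<d d≤N)
  where
  to : V d ℤ.< V e → e < d
  to Vd<Ve with ℕₚ.<-cmp e d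
  ... | tri< e<d _ _ = e<d
  ... | tri≈ _ refl _ = contradiction Vd<Ve (ℤₚ.<-irrefl refl)
  ... | tri> _ _ d<e = contradiction (DecreasingOn-antitone decr 1≤d d<e e≤N) (ℤₚ.<-asym Vd<Ve)

module Sorting (N : ℕ) where
  open KeyOrder N

  #above-antitone : ∀ κ {X Y} → X ℤ.≤ Y → #above κ Y ≤ #above κ X
  #above-antitone κ X≤Y = count-mono N (λ j _ _ Y<κj → fromWitness (ℤₚ.≤-<-trans X≤Y (toWitness Y<κj)))

  #above-strict : ∀ κ {X j} → 1 ≤ j → j ≤ N → X ℤ.< κ j → #above κ (κ j) < #above κ X
  #above-strict κ 1≤j j≤N X<κj =
    count-mono-< N (λ l _ _ κj<κl → fromWitness (ℤₚ.<-trans X<κj (toWitness κj<κl))) 1≤j j≤N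
      (ℤₚ.<-irrefl refl ∘ toWitness) (fromWitness X<κj)

  #above-sorted : ∀ κ {ρ τ c} → LeftInverseOn N τ ρ → LeftInverseOn N ρ τ → DecreasingOn 1 N (κ ∘ τ) →
                  suc c ≤ N → #above κ (κ (τ (suc c))) ≡ c
  #above-sorted κ {ρ} {τ} {c} τ∘ρ ρ∘τ decr c<N =
    trans (count-cong N pointwise) (count-preimage-≤ τ∘ρ ρ∘τ (ℕₚ.<⇒≤ c<N))
    where
    pointwise : ∀ j → 1 ≤ j → j ≤ N → ⌊ κ (τ (suc c)) ℤ.<? κ j ⌋ ≡ ⌊ ρ j ≤? c ⌋
    pointwise j 1≤j j≤N with τ∘ρ j 1≤j j≤N
    ... | 1≤ρj , ρj≤N , τρj≡j = ⌊⌋-cong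
      (subst (λ i → κ (τ (suc c)) ℤ.< κ i ⇔ ρ j ≤ c) τρj≡j (mk⇔ (ℕₚ.≤-pred ∘ to) (from ∘ s≤s)))
      (κ (τ (suc c)) ℤ.<? κ j) (ρ j ≤? c)
      where open Equivalence (DecreasingOn-<⇔ decr (s≤s z≤n) c<N 1≤ρj ρj≤N)

  rank-sorted : ∀ b {ρ τ d} → LeftInverseOn N τ ρ → LeftInverseOn N ρ τ → DecreasingOn 1 N (keyOf b ∘ τ) →
                1 ≤ d → d ≤ N → rank N b (τ d) ≡ d
  rank-sorted b {τ = τ} {suc c} τ∘ρ ρ∘τ decr _ c<N with ρ∘τ (suc c) (s≤s z≤n) c<N
  ... | 1≤τd , τd≤N , _ =
    trans (rank≡suc-#above b (τ (suc c)) 1≤τd τd≤N) (cong suc (#above-sorted (keyOf b) τ∘ρ ρ∘τ decr c<N))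

  rank-injective : ∀ a {p q} → 1 ≤ p → p ≤ N → 1 ≤ q → q ≤ N → rank N a p ≡ rank N a q → p ≡ q
  rank-injective a {p} {q} 1≤p p≤N 1≤q q≤N rp≡rq = from-cmp (ℤₚ.<-cmp (κ p) (κ q))
    where
    κ = keyOf a
    #above≡ : #above κ (κ p) ≡ #above κ (κ q)
    #above≡ = ℕₚ.suc-injective (trans (sym (rank≡suc-#above a p 1≤p p≤N)) (trans rp≡rq (rank≡suc-#above a q 1≤q q≤N)))
    from-cmp : Tri (κ p ℤ.< κ q) (κ p ≡ κ q) (κ q ℤ.< κ p) → p ≡ q
    from-cmp (tri< κp<κq _ _) = contradiction (sym #above≡) (ℕₚ.<⇒≢ (#above-strict κ 1≤q q≤N κp<κq))
    from-cmp (tri≈ _ κp≡κq _) = key-injective (a p) (a q) p≤N q≤N κp≡κq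
    from-cmp (tri> _ _ κq<κp) = contradiction #above≡ (ℕₚ.<⇒≢ (#above-strict κ 1≤p p≤N κq<κp))

  rank-range : ∀ a {p} → 1 ≤ p → p ≤ N → (1 ≤ rank N a p) × (rank N a p ≤ N)
  rank-range a {p} 1≤p p≤N rewrite rank≡suc-#above a p 1≤p p≤N =
    s≤s z≤n , count<n N 1≤p p≤N (ℤₚ.<-irrefl refl ∘ toWitness)

module SortedBy (N : ℕ) (a : ℕ → ℤ) (w : ℕ → ℕ) (w-sorts : LeftInverseOn N (rank N a) w) where
  open KeyOrder N
  open Sorting N

  κ K : ℕ → ℤ
  κ = keyOf a
  K = κ ∘ w

  #above-K : ∀ {c} → suc c ≤ N → #above κ (K (suc c)) ≡ c
  #above-K c<N with w-sorts _ (s≤s z≤n) c<N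
  ... | 1≤w , w≤N , rank≡ = ℕₚ.suc-injective (trans (sym (rank≡suc-#above a _ 1≤w w≤N)) rank≡)

  K-decreasing : DecreasingOn 1 N K
  K-decreasing (suc d) _ d<N with K (suc (suc d)) ℤ.<? K (suc d)
  ... | yes K-step = K-step
  ... | no ¬K-step = contradiction
    (subst₂ _≤_ (#above-K d<N) (#above-K (ℕₚ.<⇒≤ d<N)) (#above-antitone κ (ℤₚ.≮⇒≥ ¬K-step)))
    (ℕₚ.<-irrefl refl)

  rank-sorts : LeftInverseOn N w (rank N a)
  rank-sorts j 1≤j j≤N with rank-range a 1≤j j≤N
  ... | 1≤r , r≤N with w-sorts (rank N a j) 1≤r r≤N
  ...   | 1≤w , w≤N , rank≡ = 1≤r , r≤N , rank-injective a 1≤w w≤N 1≤j j≤N rank≡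

  #above≡⇒<K : ∀ {X c} → #above κ X ≡ suc c → suc c ≤ N → X ℤ.< K (suc c)
  #above≡⇒<K {X} {c} #above≡ c<N with X ℤ.<? K (suc c)
  ... | yes X<K = X<K
  ... | no X≮K = contradiction
    (subst₂ _≤_ #above≡ (#above-K c<N) (#above-antitone κ (ℤₚ.≮⇒≥ X≮K))) (ℕₚ.<-irrefl refl)

  #above≡⇒K≤ : ∀ {X c} → #above κ X ≡ c → suc c ≤ N → K (suc c) ℤ.≤ X
  #above≡⇒K≤ {X} {c} #above≡ c<N with w-sorts _ (s≤s z≤n) c<N
  ... | 1≤w , w≤N , _ = ℤₚ.≮⇒≥ λ X<K →
    ℕₚ.<-irrefl (trans (#above-K c<N) (sym #above≡)) (#above-strict κ 1≤w w≤N X<K)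

  K1-maximal : 1 ≤ N → ∀ l → 1 ≤ l → l ≤ N → ¬ (K 1 ℤ.< κ l)
  K1-maximal 1≤N l 1≤l l≤N K1<κl = count≡0 N (#above-K 1≤N) 1≤l l≤N (fromWitness K1<κl)

-- x₁ = w 1 carries the largest key, so α x₁ is maximal and no earlier position attains it; this is
-- what reconciles the two halves of the leg length with the keys above key (+ c) x₁.
module LegLength (N : ℕ) (α w : ℕ → ℕ) (w-sorts : LeftInverseOn N (rank N (λ j → + α j)) w) (1≤N : 1 ≤ N) where
  open KeyOrder N
  open SortedBy N (λ j → + α j) w w-sorts

  x₁ : ℕ
  x₁ = w 1

  1≤x₁ : 1 ≤ x₁
  1≤x₁ = proj₁ (w-sorts 1 (s≤s z≤n) 1≤N)

  x₁≤N : x₁ ≤ N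
  x₁≤N = proj₁ (proj₂ (w-sorts 1 (s≤s z≤n) 1≤N))

  α≤αx₁ : ∀ l → 1 ≤ l → l ≤ N → α l ≤ α x₁
  α≤αx₁ l 1≤l l≤N = ℕₚ.≮⇒≥ λ αx₁<αl →
    K1-maximal 1≤N l 1≤l l≤N (Equivalence.from (key-<⇔ (+ α x₁) (+ α l) x₁≤N l≤N) (inj₁ (ℤ.+<+ αx₁<αl)))

  α<αx₁ : ∀ l → 1 ≤ l → l < x₁ → α l < α x₁
  α<αx₁ l 1≤l l<x₁ = ℕₚ.≤∧≢⇒< (α≤αx₁ l 1≤l l≤N) λ αl≡αx₁ →
    K1-maximal 1≤N l 1≤l l≤N
      (Equivalence.from (key-<⇔ (+ α x₁) (+ α l) x₁≤N l≤N) (inj₂ (cong +_ (sym αl≡αx₁) , l<x₁)))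
    where l≤N = ℕₚ.≤-trans (ℕₚ.<⇒≤ l<x₁) x₁≤N

  x₁∸1<x₁ : x₁ ∸ 1 < x₁
  x₁∸1<x₁ = ℕₚ.∸-monoʳ-< (s≤s z≤n) 1≤x₁

  #above-leg : ∀ {c} → c < α x₁ → #above κ (key (+ c) x₁) ≡ suc (leg N α x₁ (suc c))
  #above-leg {c} c<αx₁ = begin
    count S N
      ≡⟨ sym (count-+ N add-x₁) ⟩
    count S′ N + count (λ l → ⌊ l ≟ x₁ ⌋) N
      ≡⟨ cong₂ _+_ (sym (count-+ N split)) (count-≟ N 1≤x₁ x₁≤N) ⟩
    count P₁ N + count (λ l → ⌊ l ≤? x₁ ∸ 1 ⌋ ∧ P₂ l) N + 1
      ≡⟨ cong (λ k → count P₁ N + k + 1) (count-≤-restrict N (ℕₚ.≤-trans (ℕₚ.m∸n≤m x₁ 1) x₁≤N)) ⟩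
    leg N α x₁ (suc c) + 1
      ≡⟨ ℕₚ.+-comm _ 1 ⟩
    suc (leg N α x₁ (suc c)) ∎
    where
    open ≡-Reasoning
    S S′ P₁ P₂ : ℕ → Bool
    S l = ⌊ key (+ c) x₁ ℤ.<? κ l ⌋
    S′ l = S l ∧ not ⌊ l ≟ x₁ ⌋
    P₁ l = ⌊ x₁ <? l ⌋ ∧ (⌊ suc c ≤? α l ⌋ ∧ ⌊ α l ≤? α x₁ ⌋)
    P₂ l = ⌊ suc c ≤? suc (α l) ⌋ ∧ ⌊ suc (α l) ≤? α x₁ ⌋

    add-x₁ : ∀ l → 1 ≤ l → l ≤ N → indicator (S′ l) + indicator ⌊ l ≟ x₁ ⌋ ≡ indicator (S l)
    add-x₁ l _ _ with l ≟ x₁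
    ... | yes refl rewrite ⌊⌋-true (key (+ c) x₁ ℤ.<? κ x₁) (key-<-value x₁≤N (ℤ.+<+ c<αx₁)) = refl
    ... | no _ rewrite ∧-identityʳ (S l) = ℕₚ.+-identityʳ _

    after-x₁ : ∀ l → l ≤ N → x₁ < l → S l ≡ ⌊ suc c ≤? α l ⌋
    after-x₁ l l≤N x₁<l = ⌊⌋-cong (mk⇔ to from) _ _
      where
      to : key (+ c) x₁ ℤ.< κ l → suc c ≤ α l
      to c<l with Equivalence.to (key-<⇔ (+ c) (+ α l) x₁≤N l≤N) c<l
      ... | inj₁ c<αl = ℤₚ.drop‿+<+ c<αl
      ... | inj₂ (_ , l<x₁) = contradiction l<x₁ (ℕₚ.<-asym x₁<l)
      from : suc c ≤ α l → key (+ c) x₁ ℤ.< κ l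
      from c<αl = Equivalence.from (key-<⇔ (+ c) (+ α l) x₁≤N l≤N) (inj₁ (ℤ.+<+ c<αl))

    before-x₁ : ∀ l → l < x₁ → S l ≡ ⌊ suc c ≤? suc (α l) ⌋
    before-x₁ l l<x₁ = ⌊⌋-cong (mk⇔ to from) _ _
      where
      l≤N = ℕₚ.≤-trans (ℕₚ.<⇒≤ l<x₁) x₁≤N
      to : key (+ c) x₁ ℤ.< κ l → suc c ≤ suc (α l)
      to c<l with Equivalence.to (key-<⇔ (+ c) (+ α l) x₁≤N l≤N) c<l
      ... | inj₁ c<αl = ℕₚ.<⇒≤ (s≤s (ℤₚ.drop‿+<+ c<αl))
      ... | inj₂ (c≡αl , _) = s≤s (ℕₚ.≤-reflexive (ℤₚ.+-injective c≡αl))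
      from : suc c ≤ suc (α l) → key (+ c) x₁ ℤ.< κ l
      from (s≤s c≤αl) with ℕₚ.m≤n⇒m<n∨m≡n c≤αl
      ... | inj₁ c<αl = Equivalence.from (key-<⇔ (+ c) (+ α l) x₁≤N l≤N) (inj₁ (ℤ.+<+ c<αl))
      ... | inj₂ c≡αl = Equivalence.from (key-<⇔ (+ c) (+ α l) x₁≤N l≤N) (inj₂ (cong +_ c≡αl , l<x₁))

    split : ∀ l → 1 ≤ l → l ≤ N → indicator (P₁ l) + indicator (⌊ l ≤? x₁ ∸ 1 ⌋ ∧ P₂ l) ≡ indicator (S′ l)
    split l 1≤l l≤N with ℕₚ.<-cmp l x₁
    ... | tri< l<x₁ l≢x₁ _
      rewrite ⌊⌋-false (x₁ <? l) (ℕₚ.<-asym l<x₁) | ⌊⌋-true (l ≤? x₁ ∸ 1) (ℕₚ.∸-monoˡ-≤ 1 l<x₁)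
            | ⌊⌋-true (suc (α l) ≤? α x₁) (α<αx₁ l 1≤l l<x₁) | ⌊⌋-false (l ≟ x₁) l≢x₁
            | ∧-identityʳ ⌊ suc c ≤? suc (α l) ⌋ | ∧-identityʳ (S l) | before-x₁ l l<x₁ = refl
    ... | tri≈ _ refl _
      rewrite ⌊⌋-false (l <? l) (ℕₚ.<-irrefl refl) | ⌊⌋-false (l ≤? l ∸ 1) (ℕₚ.<⇒≱ x₁∸1<x₁)
            | ⌊⌋-true (l ≟ l) refl | ∧-zeroʳ (S l) = refl
    ... | tri> _ l≢x₁ x₁<l
      rewrite ⌊⌋-true (x₁ <? l) x₁<l
            | ⌊⌋-false (l ≤? x₁ ∸ 1) (λ l≤x₁-1 → ℕₚ.<-asym x₁<l (ℕₚ.≤-<-trans l≤x₁-1 x₁∸1<x₁))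
            | ⌊⌋-true (α l ≤? α x₁) (α≤αx₁ l 1≤l l≤N) | ⌊⌋-false (l ≟ x₁) l≢x₁
            | ∧-identityʳ ⌊ suc c ≤? α l ⌋ | ∧-identityʳ (S l) | after-x₁ l l≤N x₁<l = ℕₚ.+-identityʳ _

-- Along w, block 1 is (0, t], block 2 is (t, m], block 3 is (m, m + T] and block 4 is (m + T, N]; β adds
-- D₁, D₂, D₃ and 0 to a on them.  σ lists the blocks in the order 3, 2, 1, 4, and the last four
-- hypotheses compare the keys of β on either side of each seam of that list.
module Rearrangement
  (N : ℕ) (a β : ℕ → ℤ) (w : ℕ → ℕ) (w-sorts : LeftInverseOn N (rank N a) w)
  (m t u T : ℕ) (m≡t+u : m ≡ t + u) (1≤t : 1 ≤ t) (1≤T : 1 ≤ T) (m+T≤N : m + T ≤ N)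
  (D₁ D₂ D₃ : ℤ)
  (β₁ : ∀ i → 1 ≤ i → i ≤ t → β (w i) ≡ a (w i) ℤ.+ D₁)
  (β₂ : ∀ i → t < i → i ≤ m → β (w i) ≡ a (w i) ℤ.+ D₂)
  (β₃ : ∀ i → m + 1 ≤ i → i ≤ m + T → β (w i) ≡ a (w i) ℤ.+ D₃)
  (β₄ : ∀ i → m + T < i → i ≤ N → β (w i) ≡ a (w i))
  (first₂<last₃ : 1 ≤ u → KeyOrder.key N (a (w (t + 1)) ℤ.+ D₂) (w (t + 1))
                            ℤ.< KeyOrder.key N (a (w (m + T)) ℤ.+ D₃) (w (m + T)))
  (first₁<last₃ : u ≡ 0 → KeyOrder.key N (a (w 1) ℤ.+ D₁) (w 1)
                            ℤ.< KeyOrder.key N (a (w (m + T)) ℤ.+ D₃) (w (m + T)))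
  (first₁<last₂ : KeyOrder.key N (a (w 1) ℤ.+ D₁) (w 1) ℤ.< KeyOrder.key N (a (w m) ℤ.+ D₂) (w m))
  (first₄<last₁ : m + T + 1 ≤ N → KeyOrder.keyOf N a (w (m + T + 1))
                                    ℤ.< KeyOrder.key N (a (w t) ℤ.+ D₁) (w t))
  where
  open KeyOrder N
  open Sorting N
  open SortedBy N a w w-sorts

  Kβ : ℕ → ℤ
  Kβ = keyOf β ∘ w

  σ π : ℕ → ℕ
  σ = swapBlocks 0 m T ∘ swapBlocks T t u
  π = swapBlocks T u t ∘ swapBlocks 0 T m

  T+u+t≡m+T : T + u + t ≡ m + T
  T+u+t≡m+T = subst (λ m → T + u + t ≡ m + T) (sym m≡t+u) (solve T u t)
    where solve : ∀ T u t → T + u + t ≡ t + u + T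
          solve = NR.solve-∀

  T+u+t≤N : T + u + t ≤ N
  T+u+t≤N = subst (_≤ N) (sym T+u+t≡m+T) m+T≤N

  t+u≤N : t + u ≤ N
  t+u≤N = subst (_≤ N) m≡t+u (ℕₚ.m+n≤o⇒m≤o m m+T≤N)

  π∘σ : LeftInverseOn N π σ
  π∘σ = LeftInverseOn-∘ {g = swapBlocks T u t} {swapBlocks T t u} {swapBlocks 0 T m} {swapBlocks 0 m T}
    (swapBlocks-leftInverse {o = T} {t} {u} T+u+t≤N)
    (swapBlocks-leftInverse {o = 0} {m} {T} (subst (_≤ N) (ℕₚ.+-comm m T) m+T≤N))

  σ∘π : LeftInverseOn N σ π
  σ∘π = LeftInverseOn-∘ {g = swapBlocks 0 m T} {swapBlocks 0 T m} {swapBlocks T t u} {swapBlocks T u t}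
    (swapBlocks-leftInverse {o = 0} {T} {m} m+T≤N)
    (swapBlocks-leftInverse {o = T} {u} {t} (subst (_≤ N) (sym T+t+u≡m+T) m+T≤N))
    where T+t+u≡m+T : T + t + u ≡ m + T
          T+t+u≡m+T = trans (ℕₚ.+-assoc T t u) (trans (cong (λ k → T + k) (sym m≡t+u)) (ℕₚ.+-comm T m))

  σ-block₃ : ∀ {i} → 1 ≤ i → i ≤ T → σ i ≡ m + i
  σ-block₃ 1≤i i≤T = trans (cong (swapBlocks 0 m T) (swapBlocks-below i≤T)) (swapBlocks-second 1≤i i≤T)

  σ-block₂ : ∀ {i} → 1 ≤ i → i ≤ u → σ (T + i) ≡ t + i
  σ-block₂ {i} 1≤i i≤u = begin
    σ (T + i)                      ≡⟨ cong (swapBlocks 0 m T)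
                                            (swapBlocks-second (ℕₚ.m<m+n T 1≤i) (ℕₚ.+-monoʳ-≤ T i≤u)) ⟩
    swapBlocks 0 m T (t + (T + i)) ≡⟨ swapBlocks-first T<t+T+i t+T+i≤T+m ⟩
    t + (T + i) ∸ T                ≡⟨ cong (_∸ T) (ℕₚ.+-comm t (T + i)) ⟩
    T + i + t ∸ T                  ≡⟨ cong (_∸ T) (ℕₚ.+-assoc T i t) ⟩
    T + (i + t) ∸ T                ≡⟨ ℕₚ.m+n∸m≡n T (i + t) ⟩
    i + t                          ≡⟨ ℕₚ.+-comm i t ⟩
    t + i                          ∎
    where
    open ≡-Reasoning
    T<t+T+i = ℕₚ.≤-trans (ℕₚ.m<m+n T 1≤i) (ℕₚ.m≤n+m (T + i) t)
    t+T+i≤T+m : t + (T + i) ≤ T + m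
    t+T+i≤T+m = subst₂ _≤_ (solve t T i) (cong (λ k → T + k) (sym m≡t+u)) (ℕₚ.+-monoʳ-≤ T (ℕₚ.+-monoʳ-≤ t i≤u))
      where solve : ∀ t T i → T + (t + i) ≡ t + (T + i)
            solve = NR.solve-∀

  σ-block₁ : ∀ {i} → 1 ≤ i → i ≤ t → σ (T + u + i) ≡ i
  σ-block₁ {i} 1≤i i≤t = begin
    σ (T + u + i)                    ≡⟨ cong (swapBlocks 0 m T)
                                              (swapBlocks-first (ℕₚ.m<m+n (T + u) 1≤i) (ℕₚ.+-monoʳ-≤ (T + u) i≤t)) ⟩
    swapBlocks 0 m T (T + u + i ∸ u) ≡⟨ cong (swapBlocks 0 m T) T+u+i∸u≡T+i ⟩
    swapBlocks 0 m T (T + i)         ≡⟨ swapBlocks-first (ℕₚ.m<m+n T 1≤i) (ℕₚ.+-monoʳ-≤ T i≤m) ⟩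
    T + i ∸ T                        ≡⟨ ℕₚ.m+n∸m≡n T i ⟩
    i                                ∎
    where
    open ≡-Reasoning
    T+u+i∸u≡T+i = trans (cong (_∸ u) (+-right-comm T u i)) (ℕₚ.m+n∸n≡m (T + i) u)
    i≤m = ℕₚ.≤-trans i≤t (ℕₚ.≤-trans (ℕₚ.m≤m+n t u) (ℕₚ.≤-reflexive (sym m≡t+u)))

  σ-block₄ : ∀ {d} → m + T < d → σ d ≡ d
  σ-block₄ {d} m+T<d = trans (cong (swapBlocks 0 m T) (swapBlocks-above (subst (_< d) (sym T+u+t≡m+T) m+T<d)))
                            (swapBlocks-above (subst (_< d) (ℕₚ.+-comm m T) m+T<d))

  V : ℕ → ℤ
  V = Kβ ∘ σ

  V-shift : ∀ d {c D} → σ d ≡ c → β (w c) ≡ a (w c) ℤ.+ D → V d ≡ key (a (w c) ℤ.+ D) (w c)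
  V-shift d {c} σd≡c β≡ = trans (cong Kβ σd≡c) (cong (λ A → key A (w c)) β≡)

  V-fixed : ∀ d {c} → σ d ≡ c → m + T < c → c ≤ N → V d ≡ K c
  V-fixed d {c} σd≡c m+T<c c≤N = trans (cong Kβ σd≡c) (cong (λ A → key A (w c)) (β₄ c m+T<c c≤N))

  t+1≤m : 1 ≤ u → t + 1 ≤ m
  t+1≤m 1≤u = subst (t + 1 ≤_) (sym m≡t+u) (ℕₚ.+-monoʳ-≤ t 1≤u)

  V[T]≡ : V T ≡ key (a (w (m + T)) ℤ.+ D₃) (w (m + T))
  V[T]≡ = V-shift T (σ-block₃ 1≤T ℕₚ.≤-refl) (β₃ (m + T) (ℕₚ.+-monoʳ-≤ m 1≤T) ℕₚ.≤-refl)

  V[T+u+1]≡ : V (suc (T + u)) ≡ key (a (w 1) ℤ.+ D₁) (w 1)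
  V[T+u+1]≡ = V-shift (suc (T + u)) (trans (cong σ (ℕₚ.+-comm 1 (T + u))) (σ-block₁ (s≤s z≤n) 1≤t))
                      (β₁ 1 ℕₚ.≤-refl 1≤t)

  decreasing₃ : DecreasingOn 1 T V
  decreasing₃ = DecreasingOn-block (D₃ ℤ.* + suc N) K-decreasing m+T≤N λ i 1≤i i≤T →
    trans (V-shift i (σ-block₃ 1≤i i≤T) (β₃ (m + i) (ℕₚ.+-monoʳ-≤ m 1≤i) (ℕₚ.+-monoʳ-≤ m i≤T)))
          (key-+ (a (w (m + i))) D₃ (w (m + i)))

  decreasing₂ : DecreasingOn (suc T) (T + u) V
  decreasing₂ = DecreasingOn-block (D₂ ℤ.* + suc N) K-decreasing t+u≤N λ i 1≤i i≤u →
    trans (V-shift (T + i) (σ-block₂ 1≤i i≤u)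
                   (β₂ (t + i) (ℕₚ.m<m+n t 1≤i) (subst (t + i ≤_) (sym m≡t+u) (ℕₚ.+-monoʳ-≤ t i≤u))))
          (key-+ (a (w (t + i))) D₂ (w (t + i)))

  decreasing₁ : DecreasingOn (suc (T + u)) (T + u + t) V
  decreasing₁ = DecreasingOn-block (D₁ ℤ.* + suc N) K-decreasing (ℕₚ.m+n≤o⇒m≤o t t+u≤N) λ i 1≤i i≤t →
    trans (V-shift (T + u + i) (σ-block₁ 1≤i i≤t) (β₁ i 1≤i i≤t)) (key-+ (a (w i)) D₁ (w i))

  decreasing₄ : DecreasingOn (suc (T + u + t)) (T + u + t + (N ∸ (T + u + t))) V
  decreasing₄ = DecreasingOn-block (+ 0) K-decreasing (ℕₚ.≤-reflexive (ℕₚ.m+[n∸m]≡n T+u+t≤N)) λ i 1≤i i≤ →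
    let m+T<d = subst (_< T + u + t + i) T+u+t≡m+T (ℕₚ.m<m+n (T + u + t) 1≤i)
        d≤N = subst (T + u + t + i ≤_) (ℕₚ.m+[n∸m]≡n T+u+t≤N) (ℕₚ.+-monoʳ-≤ (T + u + t) i≤)
    in trans (V-fixed (T + u + t + i) (σ-block₄ m+T<d) m+T<d d≤N) (sym (ℤₚ.+-identityʳ _))

  seam₃₂ : suc T ≤ T + u → V (suc T) ℤ.< V T
  seam₃₂ T<T+u = subst₂ ℤ._<_
    (sym (V-shift (suc T) (trans (cong σ (ℕₚ.+-comm 1 T)) (σ-block₂ (s≤s z≤n) 1≤u))
                  (β₂ (t + 1) (ℕₚ.m<m+n t (s≤s z≤n)) (t+1≤m 1≤u))))
    (sym V[T]≡) (first₂<last₃ 1≤u)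
    where 1≤u = ℕₚ.+-cancelˡ-≤ T 1 u (subst (_≤ T + u) (ℕₚ.+-comm 1 T) T<T+u)

  seam₂₁ : suc (T + u) ≤ T + u + t → V (suc (T + u)) ℤ.< V (T + u)
  seam₂₁ _ with u ℕ.≟ 0
  ... | yes u≡0 = subst₂ ℤ._<_ (sym V[T+u+1]≡)
    (sym (trans (cong (λ k → V (T + k)) u≡0) (trans (cong V (ℕₚ.+-identityʳ T)) V[T]≡)))
    (first₁<last₃ u≡0)
  ... | no u≢0 = subst₂ ℤ._<_ (sym V[T+u+1]≡)
    (sym (V-shift (T + u) (trans (σ-block₂ 1≤u ℕₚ.≤-refl) (sym m≡t+u))
                  (β₂ m (ℕₚ.≤-trans (ℕₚ.≤-reflexive (ℕₚ.+-comm 1 t)) (t+1≤m 1≤u)) ℕₚ.≤-refl)))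
    first₁<last₂
    where 1≤u = ℕₚ.n≢0⇒n>0 u≢0

  seam₁₄ : suc (T + u + t) ≤ N → V (suc (T + u + t)) ℤ.< V (T + u + t)
  seam₁₄ T+u+t<N = subst₂ ℤ._<_
    (sym (V-fixed (suc (T + u + t)) (trans (σ-block₄ m+T<next) next≡)
                  (subst (m + T <_) next≡ m+T<next) (subst (_≤ N) next≡ T+u+t<N)))
    (sym (V-shift (T + u + t) (σ-block₁ 1≤t ℕₚ.≤-refl) (β₁ t 1≤t ℕₚ.≤-refl)))
    (first₄<last₁ (subst (_≤ N) next≡ T+u+t<N))
    where
    next≡ : suc (T + u + t) ≡ m + T + 1
    next≡ = trans (ℕₚ.+-comm 1 _) (cong (_+ 1) T+u+t≡m+T)
    m+T<next : m + T < suc (T + u + t)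
    m+T<next = s≤s (ℕₚ.≤-reflexive (sym T+u+t≡m+T))

  V-decreasing : DecreasingOn 1 N V
  V-decreasing = subst (λ b → DecreasingOn 1 b V) (ℕₚ.m+[n∸m]≡n T+u+t≤N)
    (DecreasingOn-join (DecreasingOn-join (DecreasingOn-join decreasing₃ seam₃₂ decreasing₂) seam₂₁ decreasing₁)
                       (seam₁₄ ∘ subst (suc (T + u + t) ≤_) (ℕₚ.m+[n∸m]≡n T+u+t≤N)) decreasing₄)

  rank-σ : ∀ {d} → 1 ≤ d → d ≤ N → rank N β (w (σ d)) ≡ d
  rank-σ = rank-sorted β {π ∘ rank N a} {w ∘ σ}
    (LeftInverseOn-∘ {g = w} {rank N a} {σ} {π} rank-sorts σ∘π)
    (LeftInverseOn-∘ {g = π} {σ} {rank N a} {w} π∘σ w-sorts)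
    V-decreasing

  rank-block₃ : ∀ i → 1 ≤ i → i ≤ T → rank N β (w (m + i)) ≡ i
  rank-block₃ i 1≤i i≤T = subst (λ c → rank N β (w c) ≡ i) (σ-block₃ 1≤i i≤T)
    (rank-σ 1≤i (ℕₚ.≤-trans i≤T (ℕₚ.m+n≤o⇒n≤o m m+T≤N)))

  rank-block₂ : ∀ i → 1 ≤ i → i ≤ u → rank N β (w (t + i)) ≡ T + i
  rank-block₂ i 1≤i i≤u = subst (λ c → rank N β (w c) ≡ T + i) (σ-block₂ 1≤i i≤u)
    (rank-σ (ℕₚ.≤-trans 1≤i (ℕₚ.m≤n+m i T))
            (ℕₚ.≤-trans (ℕₚ.+-monoʳ-≤ T i≤u) (ℕₚ.m+n≤o⇒m≤o (T + u) T+u+t≤N)))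

  rank-block₁ : ∀ i → 1 ≤ i → i ≤ t → rank N β (w i) ≡ T + u + i
  rank-block₁ i 1≤i i≤t = subst (λ c → rank N β (w c) ≡ T + u + i) (σ-block₁ 1≤i i≤t)
    (rank-σ (ℕₚ.≤-trans 1≤i (ℕₚ.m≤n+m i (T + u))) (ℕₚ.≤-trans (ℕₚ.+-monoʳ-≤ (T + u) i≤t) T+u+t≤N))

  rank-block₄ : ∀ i → m + T < i → i ≤ N → rank N β (w i) ≡ i
  rank-block₄ i m+T<i i≤N = subst (λ c → rank N β (w c) ≡ i) (σ-block₄ m+T<i)
    (rank-σ (ℕₚ.≤-trans (s≤s z≤n) m+T<i) i≤N)

-- α̃ and ξ as keys

toℚᵘ-homo-- : ∀ p q → toℚᵘ (p ℚ.- q) ℚᵘ.≃ toℚᵘ p ℚᵘ.- toℚᵘ q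
toℚᵘ-homo-- p q = ℚᵘₚ.≃-trans (toℚᵘ-homo-+ p (ℚ.- q)) (ℚᵘₚ.+-congʳ (toℚᵘ p) (toℚᵘ-homo‿- q))

integer-minus-fraction : ∀ A B N → mkℚᵘ A 0 ℚᵘ.- mkℚᵘ B N ℚᵘ.≃ mkℚᵘ (A ℤ.* + suc N ℤ.- B) N
integer-minus-fraction A B N = *≡* (trans (solve A B (+ suc N))
  (cong (λ n → (A ℤ.* + suc N ℤ.- B) ℤ.* + suc n) (sym (ℕₚ.+-identityʳ N))))
  where solve : ∀ a b m → (a ℤ.* m ℤ.+ ℤ.- b ℤ.* ℤ.+ 1) ℤ.* m ≡ (a ℤ.* m ℤ.- b) ℤ.* m
        solve = ZR.solve-∀

fraction-minus-integer : ∀ A C N → mkℚᵘ A N ℚᵘ.- mkℚᵘ C 0 ℚᵘ.≃ mkℚᵘ (A ℤ.- C ℤ.* + suc N) N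
fraction-minus-integer A C N = *≡* (trans (solve A C (+ suc N))
  (cong (λ n → (A ℤ.- C ℤ.* + suc N) ℤ.* + suc n) (sym (ℕₚ.*-identityʳ N))))
  where solve : ∀ a c m → (a ℤ.* ℤ.+ 1 ℤ.+ ℤ.- c ℤ.* m) ℤ.* m ≡ (a ℤ.- c ℤ.* m) ℤ.* m
        solve = ZR.solve-∀

module _ (N : ℕ) (α : ℕ → ℕ) where
  open KeyOrder N

  toℚᵘ-tilde : ∀ x → toℚᵘ (tilde N α x) ℚᵘ.≃ mkℚᵘ (key (+ α x) x) N
  toℚᵘ-tilde x = ℚᵘₚ.≃-trans (toℚᵘ-homo-- (+ α x ℚ./ 1) (+ x ℚ./ suc N))
    (ℚᵘₚ.≃-trans (ℚᵘₚ.+-cong (toℚᵘ-fromℚᵘ (mkℚᵘ (+ α x) 0))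
                              (ℚᵘₚ.-‿cong (toℚᵘ-fromℚᵘ (mkℚᵘ (+ x) N))))
                  (integer-minus-fraction (+ α x) (+ x) N))

  toℚᵘ-tilde-shift : ∀ x c → toℚᵘ (tilde N α x ℚ.- (+ c ℚ./ 1)) ℚᵘ.≃ mkℚᵘ (key (+ α x ℤ.- + c) x) N
  toℚᵘ-tilde-shift x c = ℚᵘₚ.≃-trans (toℚᵘ-homo-- (tilde N α x) (+ c ℚ./ 1))
    (ℚᵘₚ.≃-trans (ℚᵘₚ.+-cong (toℚᵘ-tilde x) (ℚᵘₚ.-‿cong (toℚᵘ-fromℚᵘ (mkℚᵘ (+ c) 0))))
                  (subst (λ K → mkℚᵘ (key (+ α x) x) N ℚᵘ.- mkℚᵘ (+ c) 0 ℚᵘ.≃ mkℚᵘ K N) key≡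
                         (fraction-minus-integer (key (+ α x) x) (+ c) N)))
    where key≡ : key (+ α x) x ℤ.- + c ℤ.* + suc N ≡ key (+ α x ℤ.- + c) x
          key≡ = trans (cong (λ z → key (+ α x) x ℤ.+ z) (ℤₚ.neg-distribˡ-* (+ c) (+ suc N)))
                       (sym (key-+ (+ α x) (ℤ.- + c) x))

toℚᵘ-<-sameDenominator : ∀ {p q X Y N} → toℚᵘ p ℚᵘ.≃ mkℚᵘ X N → toℚᵘ q ℚᵘ.≃ mkℚᵘ Y N →
                          p ℚ.< q → X ℤ.< Y
toℚᵘ-<-sameDenominator {N = N} p≃X q≃Y p<q with ℚᵘₚ.<-respˡ-≃ p≃X (ℚᵘₚ.<-respʳ-≃ q≃Y (toℚᵘ-mono-< p<q))
... | *<* X*M<Y*M = ℤₚ.*-cancelʳ-<-nonNeg (+ suc N) X*M<Y*M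

divMod-unique : ∀ {r m} q .{{_ : NonZero m}} → r < m → ((r + q * m) % m ≡ r) × ((r + q * m) / m ≡ q)
divMod-unique {r} {m} q r<m =
  trans (DivMod.[m+kn]%n≡m%n r q m) (DivMod.m<n⇒m%n≡m r<m) ,
  trans (DivMod.+-distrib-/-∣ʳ r (n∣m*n q)) (cong₂ _+_ (DivMod.m<n⇒m/n≡0 r<m) (DivMod.m*n/n≡m q m))

xi-at : ∀ N α w n m .{{_ : NonZero m}} {r} q → r < m →
        xi N α w n m (suc (r + q * m)) ≡ tilde N α (w (suc r)) ℚ.- (+ (n * q) ℚ./ 1)
xi-at N α w n m q r<m with divMod-unique q r<m
... | %≡ , /≡ = cong₂ (λ i j → tilde N α (w (suc i)) ℚ.- (+ (n * j) ℚ./ 1)) %≡ /≡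

-- The seams

minus-sum-plus : ∀ A a b → A ℤ.- + (a + b) ℤ.+ + b ≡ A ℤ.- + a
minus-sum-plus A a b = trans (cong (λ s → A ℤ.- s ℤ.+ + b) (ℤₚ.pos-+ a b)) (solve A (+ a) (+ b))
  where solve : ∀ A a b → A ℤ.- (a ℤ.+ b) ℤ.+ b ≡ A ℤ.- a
        solve = ZR.solve-∀

minus-minus : ∀ A a b → A ℤ.- + a ℤ.- + b ≡ A ℤ.- + (b + a)
minus-minus A a b = trans (solve A (+ a) (+ b)) (cong (λ s → A ℤ.- s) (sym (ℤₚ.pos-+ b a)))
  where solve : ∀ A a b → A ℤ.- a ℤ.- b ≡ A ℤ.- (b ℤ.+ a)
        solve = ZR.solve-∀

module Seams
  (N : ℕ) (α w : ℕ → ℕ) (w-sorts : LeftInverseOn N (rank N (λ j → + α j)) w)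
  (n : ℕ) (1≤n : 1 ≤ n) (n≤αx : n ≤ α (w 1)) (T : ℕ) (1≤T : 1 ≤ T)
  where
  open KeyOrder N
  open SortedBy N (λ j → + α j) w w-sorts

  m t k r q u : ℕ
  m = suc (leg N α (w 1) (suc (α (w 1)) ∸ n))
  t = suc ((T ∸ 1) % m)
  k = (T ∸ t) / m
  r = (T ∸ 1) % m
  q = (T ∸ 1) / m
  u = m ∸ t

  D₁ D₂ D₃ : ℤ
  D₁ = ℤ.- + ((k + 1) * n)
  D₂ = ℤ.- + (k * n)
  D₃ = + n

  t≤m : t ≤ m
  t≤m = DivMod.m%n<n (T ∸ 1) m

  m≡t+u : m ≡ t + u
  m≡t+u = sym (ℕₚ.m+[n∸m]≡n t≤m)

  T∸1≡r+qm : T ∸ 1 ≡ r + q * m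
  T∸1≡r+qm = DivMod.m≡m%n+[m/n]*n (T ∸ 1) m

  T≡t+qm : T ≡ t + q * m
  T≡t+qm = trans (sym (ℕₚ.m+[n∸m]≡n 1≤T)) (cong suc T∸1≡r+qm)

  k≡q : k ≡ q
  k≡q = trans (cong (λ X → (X ∸ t) / m) T≡t+qm) (trans (cong (_/ m) (ℕₚ.m+n∸m≡n t (q * m))) (DivMod.m*n/n≡m q m))

  T≡mk+t : T ≡ m * k + t
  T≡mk+t = trans T≡t+qm (trans (ℕₚ.+-comm t (q * m)) (cong (_+ t) (trans (ℕₚ.*-comm q m) (cong (m *_) (sym k≡q)))))

  T+u≡m[k+1] : T + u ≡ m * (k + 1)
  T+u≡m[k+1] = trans (cong (_+ u) T≡mk+t) (trans (ℕₚ.+-assoc (m * k) t u)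
    (trans (cong (λ x → m * k + x) (sym m≡t+u)) (solve m k)))
    where solve : ∀ m k → m * k + m ≡ m * (k + 1)
          solve = NR.solve-∀

  xi-key : ∀ {p r} q′ → r < m → p ≡ suc (r + q′ * m) →
           toℚᵘ (xi N α w n m p) ℚᵘ.≃ mkℚᵘ (key (+ α (w (suc r)) ℤ.- + (n * q′)) (w (suc r))) N
  xi-key {r = r} q′ r<m p≡ =
    subst (λ ξ → toℚᵘ ξ ℚᵘ.≃ _) (sym (trans (cong (xi N α w n m) p≡) (xi-at N α w n m q′ r<m)))
          (toℚᵘ-tilde-shift N α (w (suc r)) (n * q′))

  module Hypotheses (m+T≤N : m + T ≤ N)
    (below : ∀ s → 1 ≤ s → s < T → tilde N α (w (m + s)) ℚ.< xi N α w n m (m + s + 1))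
    (above : xi N α w n m (m + T + 1) ℚ.< tilde N α (w (m + T))) where

    open LegLength N α w w-sorts (ℕₚ.≤-trans 1≤T (ℕₚ.m+n≤o⇒n≤o m m+T≤N))

    m≤N : m ≤ N
    m≤N = ℕₚ.m+n≤o⇒m≤o m m+T≤N

    αx∸n<αx : α (w 1) ∸ n < α (w 1)
    αx∸n<αx = ℕₚ.∸-monoʳ-< 1≤n n≤αx

    #above-αx∸n : #above κ (key (+ (α (w 1) ∸ n)) (w 1)) ≡ m
    #above-αx∸n = trans (#above-leg αx∸n<αx) (cong (λ j → suc (leg N α (w 1) j)) (sym (ℕₚ.+-∸-assoc 1 n≤αx)))

    +[αx∸n]≡ : + (α (w 1) ∸ n) ≡ + α (w 1) ℤ.- + n
    +[αx∸n]≡ = sym (trans (ℤₚ.m-n≡m⊖n (α (w 1)) n) (ℤₚ.⊖-≥ n≤αx))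

    n*[1+q]≡ : n * suc q ≡ (k + 1) * n
    n*[1+q]≡ = trans (solve n q) (cong (λ z → (z + 1) * n) (sym k≡q))
      where solve : ∀ n q → n * suc q ≡ (q + 1) * n
            solve = NR.solve-∀

    last₃ : ℤ
    last₃ = key (+ α (w (m + T)) ℤ.+ D₃) (w (m + T))

    first₂<last₃ : 1 ≤ u → key (+ α (w (t + 1)) ℤ.+ D₂) (w (t + 1)) ℤ.< last₃
    first₂<last₃ 1≤u = subst (λ i → key (+ α (w i) ℤ.+ D₂) (w i) ℤ.< last₃) (ℕₚ.+-comm 1 t)
      (subst (λ A → key A (w (suc t)) ℤ.< last₃) value
             (key-+-mono-< (+ α (w (suc t)) ℤ.- + (n * suc q)) (w (suc t)) (+ α (w (m + T))) (w (m + T)) (+ n) ξ<α̃))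
      where
      t<m = subst (t <_) (sym m≡t+u) (subst (_≤ t + u) (ℕₚ.+-comm t 1) (ℕₚ.+-monoʳ-≤ t 1≤u))
      index : m + T + 1 ≡ suc (t + suc q * m)
      index = trans (cong (λ X → m + X + 1) T≡t+qm) (solve m t q)
        where solve : ∀ m t q → m + (t + q * m) + 1 ≡ suc (t + suc q * m)
              solve = NR.solve-∀
      ξ<α̃ : key (+ α (w (suc t)) ℤ.- + (n * suc q)) (w (suc t)) ℤ.< key (+ α (w (m + T))) (w (m + T))
      ξ<α̃ = toℚᵘ-<-sameDenominator (xi-key (suc q) t<m index) (toℚᵘ-tilde N α (w (m + T))) above
      value : + α (w (suc t)) ℤ.- + (n * suc q) ℤ.+ + n ≡ + α (w (suc t)) ℤ.+ D₂
      value = trans (cong (λ X → + α (w (suc t)) ℤ.- + X ℤ.+ + n) (trans n*[1+q]≡ (solve k n)))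
                    (minus-sum-plus (+ α (w (suc t))) (k * n) n)
        where solve : ∀ k n → (k + 1) * n ≡ k * n + n
              solve = NR.solve-∀

    first₁<last₃ : u ≡ 0 → key (+ α (w 1) ℤ.+ D₁) (w 1) ℤ.< last₃
    first₁<last₃ u≡0 = subst (λ A → key A (w 1) ℤ.< last₃) value
      (key-+-mono-< (+ α (w 1) ℤ.- + (n * suc (suc q))) (w 1) (+ α (w (m + T))) (w (m + T)) (+ n) ξ<α̃)
      where
      t≡m = sym (trans m≡t+u (trans (cong (λ x → t + x) u≡0) (ℕₚ.+-identityʳ t)))
      index : m + T + 1 ≡ suc (0 + suc (suc q) * m)
      index = trans (cong (λ X → m + X + 1) (trans T≡t+qm (cong (_+ q * m) t≡m))) (solve m q)
        where solve : ∀ m q → m + (m + q * m) + 1 ≡ suc (0 + suc (suc q) * m)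
              solve = NR.solve-∀
      ξ<α̃ : key (+ α (w 1) ℤ.- + (n * suc (suc q))) (w 1) ℤ.< key (+ α (w (m + T))) (w (m + T))
      ξ<α̃ = toℚᵘ-<-sameDenominator (xi-key (suc (suc q)) (s≤s z≤n) index) (toℚᵘ-tilde N α (w (m + T))) above
      value : + α (w 1) ℤ.- + (n * suc (suc q)) ℤ.+ + n ≡ + α (w 1) ℤ.+ D₁
      value = trans (cong (λ X → + α (w 1) ℤ.- + X ℤ.+ + n) (trans (solve n q) (cong (λ z → (z + 1) * n + n) (sym k≡q))))
                    (minus-sum-plus (+ α (w 1)) ((k + 1) * n) n)
        where solve : ∀ n q → n * suc (suc q) ≡ (q + 1) * n + n
              solve = NR.solve-∀

    key[αx∸n]<K[m] : key (+ (α (w 1) ∸ n)) (w 1) ℤ.< K m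
    key[αx∸n]<K[m] = #above≡⇒<K #above-αx∸n m≤N

    first₁<last₂ : key (+ α (w 1) ℤ.+ D₁) (w 1) ℤ.< key (+ α (w m) ℤ.+ D₂) (w m)
    first₁<last₂ = subst (λ A → key A (w 1) ℤ.< key (+ α (w m) ℤ.+ D₂) (w m)) value
      (key-+-mono-< (+ (α (w 1) ∸ n)) (w 1) (+ α (w m)) (w m) D₂ key[αx∸n]<K[m])
      where
      value : + (α (w 1) ∸ n) ℤ.+ D₂ ≡ + α (w 1) ℤ.+ D₁
      value = trans (cong (ℤ._- + (k * n)) +[αx∸n]≡) (trans (minus-minus (+ α (w 1)) n (k * n))
                (cong (λ X → + α (w 1) ℤ.- + X) (solve k n)))
        where solve : ∀ k n → k * n + n ≡ (k + 1) * n
              solve = NR.solve-∀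

    first₄<last₁-if-1<T : 1 < T → m + T + 1 ≤ N → K (m + T + 1) ℤ.< key (+ α (w t) ℤ.+ D₁) (w t)
    first₄<last₁-if-1<T 1<T m+T+1≤N =
      ℤₚ.<-trans K[m+T+1]<K[m+s] (subst (λ X → K (m + s) ℤ.< key (+ α (w t) ℤ.- + X) (w t)) n*[1+q]≡ α̃<ξ)
      where
      s = T ∸ 1
      index : m + s + 1 ≡ suc (r + suc q * m)
      index = trans (cong (λ X → m + X + 1) T∸1≡r+qm) (solve m r q)
        where solve : ∀ m r q → m + (r + q * m) + 1 ≡ suc (r + suc q * m)
              solve = NR.solve-∀
      α̃<ξ : K (m + s) ℤ.< key (+ α (w t) ℤ.- + (n * suc q)) (w t)
      α̃<ξ = toℚᵘ-<-sameDenominator (toℚᵘ-tilde N α (w (m + s))) (xi-key (suc q) (DivMod.m%n<n (T ∸ 1) m) index)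
              (below s (ℕₚ.∸-monoˡ-≤ 1 1<T) (ℕₚ.∸-monoʳ-< (s≤s z≤n) 1≤T))
      K[m+T+1]<K[m+s] : K (m + T + 1) ℤ.< K (m + s)
      K[m+T+1]<K[m+s] = DecreasingOn-antitone K-decreasing (ℕₚ.≤-trans (s≤s z≤n) (ℕₚ.m≤m+n m s))
        (ℕₚ.≤-trans (s≤s (ℕₚ.+-monoʳ-≤ m (ℕₚ.m∸n≤m T 1))) (ℕₚ.≤-reflexive (ℕₚ.+-comm 1 (m + T)))) m+T+1≤N

    -- With T = 1 no ξ-inequality is available; the leg length bounds K (m + 1) instead.
    first₄<last₁-if-1≡T : 1 ≡ T → m + T + 1 ≤ N → K (m + T + 1) ℤ.< key (+ α (w t) ℤ.+ D₁) (w t)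
    first₄<last₁-if-1≡T 1≡T m+T+1≤N = subst₂ ℤ._<_ (cong K m+2≡m+T+1) αx∸n≡
      (ℤₚ.<-≤-trans (K-decreasing (suc m) (s≤s z≤n) m+2≤N) (#above≡⇒K≤ #above-αx∸n (ℕₚ.<⇒≤ m+2≤N)))
      where
      m+2≡m+T+1 : suc (suc m) ≡ m + T + 1
      m+2≡m+T+1 = trans (solve m) (cong (λ X → m + X + 1) 1≡T)
        where solve : ∀ m → suc (suc m) ≡ m + 1 + 1
              solve = NR.solve-∀
      m+2≤N : suc (suc m) ≤ N
      m+2≤N = subst (_≤ N) (sym m+2≡m+T+1) m+T+1≤N
      αx∸n≡ : key (+ (α (w 1) ∸ n)) (w 1) ≡ key (+ α (w t) ℤ.+ D₁) (w t)
      αx∸n≡ = trans (cong (λ A → key A (w 1))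
                          (trans +[αx∸n]≡ (cong (λ X → + α (w 1) ℤ.- + X) (sym (ℕₚ.*-identityˡ n)))))
        (cong₂ (λ t k → key (+ α (w t) ℤ.- + ((k + 1) * n)) (w t))
               (sym (cong (λ X → suc ((X ∸ 1) % m)) (sym 1≡T)))
               (sym (trans k≡q (cong (λ X → (X ∸ 1) / m) (sym 1≡T)))))

    first₄<last₁ : m + T + 1 ≤ N → K (m + T + 1) ℤ.< key (+ α (w t) ℤ.+ D₁) (w t)
    first₄<last₁ = [ first₄<last₁-if-1<T , first₄<last₁-if-1≡T ]′ (ℕₚ.m≤n⇒m<n∨m≡n 1≤T)

mainTheorem6 : (N : ℕ) (α : ℕ → ℕ) → N ≡ ell N α + size N α →
    (w : ℕ → ℕ) →
    (∀ i → 1 ≤ i → i ≤ N → (1 ≤ w i) × (w i ≤ N) × (rank N (λ j → + α j) (w i) ≡ i)) →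
    (n : ℕ) → 1 ≤ n → n ≤ α (w 1) →
    let m = suc (leg N α (w 1) (suc (α (w 1)) ∸ n)) in
    (T : ℕ) → 1 ≤ T → m + T ≤ N →
    (∀ s → 1 ≤ s → s < T → tilde N α (w (m + s)) ℚ.< xi N α w n m (m + s + 1)) →
    xi N α w n m (m + T + 1) ℚ.< tilde N α (w (m + T)) →
    let t = suc ((T ∸ 1) % m) in
    let k = (T ∸ t) / m in
    (β : ℕ → ℤ) →
    (∀ i → 1 ≤ i → i ≤ t → β (w i) ≡ + α (w i) ℤ.- + ((k + 1) * n)) →
    (∀ i → t < i → i ≤ m → β (w i) ≡ + α (w i) ℤ.- + (k * n)) →
    (∀ i → m + 1 ≤ i → i ≤ m + T → β (w i) ≡ + α (w i) ℤ.+ + n) →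
    (∀ i → m + T < i → i ≤ N → β (w i) ≡ + α (w i)) →
    (∀ i → 1 ≤ i → i ≤ T → rank N β (w (m + i)) ≡ i)
    × (∀ i → 1 ≤ i → i ≤ m ∸ t → rank N β (w (t + i)) ≡ m * k + t + i)
    × (∀ i → 1 ≤ i → i ≤ t → rank N β (w i) ≡ m * (k + 1) + i)
    × (∀ i → m + T + 1 ≤ i → i ≤ N → rank N β (w i) ≡ i)
mainTheorem6 N α _ w w-sorts n 1≤n n≤αx T 1≤T m+T≤N below above β β₁ β₂ β₃ β₄ =
    rank-block₃
  , (λ i 1≤i i≤u → trans (rank-block₂ i 1≤i i≤u) (cong (_+ i) T≡mk+t))
  , (λ i 1≤i i≤t → trans (rank-block₁ i 1≤i i≤t) (cong (_+ i) T+u≡m[k+1]))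
  , (λ i m+T+1≤i → rank-block₄ i (subst (_≤ i) (ℕₚ.+-comm (m + T) 1) m+T+1≤i))
  where
  open Seams N α w w-sorts n 1≤n n≤αx T 1≤T
  open Hypotheses m+T≤N below above
  open Rearrangement N (λ j → + α j) β w w-sorts m t u T m≡t+u (s≤s z≤n) 1≤T m+T≤N D₁ D₂ D₃ β₁ β₂ β₃ β₄
    first₂<last₃ first₁<last₃ first₁<last₂ first₄<last₁
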